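{- Let $P[1\mathinner{.\,.} m]$ be a string with a CT-border-period $p\in[1,\lfloor m/2\rfloor]$. Then the position of the leftmost minimum of $P$ does not lie in the interval $(p, m-p]$, i.e., it is not in $\{p+1,\dots,m-p\}$.
   Context: Strings are finite sequences over a totally ordered alphabet; $P[i]$ is the $i$-th character (1-indexed); $P[i\mathinner{.\,.} j]$ and $P(i-1\mathinner{.\,.} j]$ denote $P[i]\cdots P[j]$. The leftmost minimum of a nonempty string $X$ is $X[j]$ for the smallest index $j$ at which the minimum value of $X$ occurs. The Cartesian tree $\mathsf{CT}(X)$: empty for the empty string; otherwise a root with left subtree $\mathsf{CT}(X[1\mathinner{.\,.} j-1])$ and right subtree $\mathsf{CT}(X[j+1\mathinner{.\,.} |X|])$, where $X[j]$ is the leftmost minimum. $X\approx Y$ iff $\mathsf{CT}(X)=\mathsf{CT}(Y)$. A string $P[1\mathinner{.\,.} m]$ has CT-border-period $p\in[1,m]$ iff $P[1\mathinner{.\,.} m-p]\approx P[p+1\mathinner{.\,.} m]$. -}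

module Defs where

open import Level using (Level)
open import Data.Nat using (ℕ; zero; suc; _+_; _∸_; _<_)
open import Data.List using (List; []; _∷_; length; take; drop)
open import Data.Product using (_×_; _,_)
open import Relation.Binary.Bundles using (StrictTotalOrder)
open import Relation.Binary.Definitions using (tri<; tri≈; tri>)
open import Relation.Binary.PropositionalEquality using (_≡_)

-- Unlabelled binary trees (shapes of Cartesian trees).
data Tree : Set where
  leaf : Tree
  node : Tree → Tree → Tree

module CartesianTree {c ℓ₁ ℓ₂ : Level} (O : StrictTotalOrder c ℓ₁ ℓ₂) where
  open StrictTotalOrder O renaming (Carrier to A)

  -- For a nonempty string x ∷ xs: (value, 0-based index) of its leftmost minimum.
  -- A later element replaces the current minimum only if strictly smaller.
  lminAux : A → List A → A × ℕ
  lminAux x [] = x , 0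
  lminAux x (y ∷ ys) with lminAux y ys
  ... | v , k with compare v x
  ...   | tri< _ _ _ = v , suc k
  ...   | tri≈ _ _ _ = x , 0
  ...   | tri> _ _ _ = x , 0

  lminIdx : A → List A → ℕ
  lminIdx x xs with lminAux x xs
  ... | _ , k = k

  -- Cartesian tree, by recursion on a fuel bound (fuel ≥ length suffices).
  ctFuel : ℕ → List A → Tree
  ctFuel _ [] = leaf
  ctFuel zero (_ ∷ _) = leaf
  ctFuel (suc n) (x ∷ xs) =
    let X = x ∷ xs ; j = lminIdx x xs
    in node (ctFuel n (take j X)) (ctFuel n (drop (suc j) X))

  CT : List A → Tree
  CT X = ctFuel (length X) X

  _≈CT_ : List A → List A → Set
  X ≈CT Y = CT X ≡ CT Y

  -- P has CT-border-period p ∈ [1, m] (m = |P|): P[1..m-p] ≈ P[p+1..m]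
  HasCTBorderPeriod : List A → ℕ → Set
  HasCTBorderPeriod P p = take (length P ∸ p) P ≈CT drop p P

  leftmostMinPos : A → List A → ℕ
  leftmostMinPos x xs = suc (lminIdx x xs)

{-# OPTIONS --safe #-}
-- The leftmost minimum of P, at 0-based index j with p ≤ j < m − p, survives in both
-- P[1..m−p] (still at j) and P[p+1..m] (now at j − p) as their leftmost minimum.
-- The left subtree of a Cartesian tree has exactly as many nodes as there are
-- characters before the leftmost minimum, so P[1..m−p] ≈ P[p+1..m] forces j = j − p,
-- which is impossible for p ≥ 1.
module Submission where

open import Defs
open import Level using (Level; _⊔_)
open import Data.Nat using (ℕ; zero; suc; _+_; _≤_; _<_; _∸_; _/_; s≤s)
open import Data.Nat.Properties
  using (suc-injective; ≤-trans; ≤-reflexive; m≤m+n; m≤n+m; <-irrefl; ∸-monoʳ-<)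
open import Data.List using (List; []; _∷_; _++_; length; take; drop)
open import Data.List.Properties using (length-++; length-++-sucʳ; length-drop; ∷-injectiveʳ)
open import Data.List.Relation.Unary.All using (All; []; _∷_)
import Data.List.Relation.Unary.All as All
open import Data.List.Relation.Unary.All.Properties using (++⁺; ++⁻ʳ; take⁺; drop⁺)
open import Data.Product using (_×_; _,_; proj₁; proj₂; ∃)
open import Function using (_∘_)
open import Relation.Nullary using (¬_; contradiction)
open import Relation.Binary.Bundles using (StrictTotalOrder)
open import Relation.Binary.Definitions using (tri<; tri≈; tri>)
open import Relation.Binary.PropositionalEquality
  using (_≡_; refl; sym; trans; cong; cong₂; module ≡-Reasoning)
open ≡-Reasoning

size : Tree → ℕ
size leaf = 0
size (node l r) = suc (size l + size r)

leftSize : Tree → ℕ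
leftSize leaf = 0
leftSize (node l _) = size l

module _ {a} {A : Set a} where

  take-length-++ : ∀ (xs ys : List A) → take (length xs) (xs ++ ys) ≡ xs
  take-length-++ [] ys = refl
  take-length-++ (x ∷ xs) ys = cong (x ∷_) (take-length-++ xs ys)

  drop-suc-length-++-∷ : ∀ (xs : List A) y ys → drop (suc (length xs)) (xs ++ y ∷ ys) ≡ ys
  drop-suc-length-++-∷ [] y ys = refl
  drop-suc-length-++-∷ (x ∷ xs) y ys = drop-suc-length-++-∷ xs y ys

  take-++-∷ : ∀ n (xs : List A) {y ys} → length xs < n →
              take n (xs ++ y ∷ ys) ≡ xs ++ y ∷ take (n ∸ suc (length xs)) ys
  take-++-∷ (suc n) [] _ = refl
  take-++-∷ (suc n) (x ∷ xs) (s≤s |xs|<n) = cong (x ∷_) (take-++-∷ n xs |xs|<n)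

  drop-++ : ∀ n (xs : List A) {ys} → n ≤ length xs → drop n (xs ++ ys) ≡ drop n xs ++ ys
  drop-++ zero xs _ = refl
  drop-++ (suc n) (x ∷ xs) (s≤s n≤|xs|) = drop-++ n xs n≤|xs|

module LeftmostMinimum {c ℓ₁ ℓ₂ : Level} (O : StrictTotalOrder c ℓ₁ ℓ₂) where
  open StrictTotalOrder O
    using (compare; irrefl; asym; <-respˡ-≈; module Eq)
    renaming (Carrier to A; _<_ to _≺_; trans to ≺-trans)
  open CartesianTree O

  record LeftmostMin (l : List A) (v : A) (k : ℕ) : Set (c ⊔ ℓ₂) where
    constructor leftmostMin
    field
      before         : List A
      after          : List A
      split          : l ≡ before ++ v ∷ after
      index          : length before ≡ k
      before-greater : All (v ≺_) before
      after-not-less : All (λ e → ¬ e ≺ v) after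

  open LeftmostMin

  ≮-trans : ∀ {x y z} → ¬ x ≺ y → ¬ y ≺ z → ¬ x ≺ z
  ≮-trans {x} {y} x≮y y≮z x≺z with compare x y
  ... | tri< x≺y _ _ = x≮y x≺y
  ... | tri≈ _ x≈y _ = y≮z (<-respˡ-≈ x≈y x≺z)
  ... | tri> _ _ y≺x = y≮z (≺-trans y≺x x≺z)

  minimal : ∀ {l v k} → LeftmostMin l v k → All (λ e → ¬ e ≺ v) l
  minimal (leftmostMin _ _ refl _ bs> as≮) = ++⁺ (All.map asym bs>) (irrefl Eq.refl ∷ as≮)

  ∷-leftmostMin-greater : ∀ {x l v k} → v ≺ x → LeftmostMin l v k → LeftmostMin (x ∷ l) v (suc k)
  ∷-leftmostMin-greater v≺x (leftmostMin bs as refl refl bs> as≮) =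
    leftmostMin (_ ∷ bs) as refl refl (v≺x ∷ bs>) as≮

  ∷-leftmostMin-head : ∀ {x l v k} → ¬ v ≺ x → LeftmostMin l v k → LeftmostMin (x ∷ l) x 0
  ∷-leftmostMin-head v≮x lm =
    leftmostMin [] _ refl refl [] (All.map (λ e≮v → ≮-trans e≮v v≮x) (minimal lm))

  lminAux-leftmostMin : ∀ x xs →
    LeftmostMin (x ∷ xs) (proj₁ (lminAux x xs)) (proj₂ (lminAux x xs))
  lminAux-leftmostMin x [] = leftmostMin [] [] refl refl [] []
  lminAux-leftmostMin x (y ∷ ys) with lminAux y ys | lminAux-leftmostMin y ys
  ... | v , k | lm with compare v x
  ...   | tri< v≺x _ _ = ∷-leftmostMin-greater v≺x lm
  ...   | tri≈ v≮x _ _ = ∷-leftmostMin-head v≮x lm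
  ...   | tri> v≮x _ _ = ∷-leftmostMin-head v≮x lm

  lminIdx-leftmostMin : ∀ x xs → ∃ λ v → LeftmostMin (x ∷ xs) v (lminIdx x xs)
  lminIdx-leftmostMin x xs with lminAux x xs | lminAux-leftmostMin x xs
  ... | v , _ | lm = v , lm

  split-index-unique : ∀ {xs₁ ys₁ xs₂ ys₂ v w} → xs₁ ++ v ∷ ys₁ ≡ xs₂ ++ w ∷ ys₂ →
    All (v ≺_) xs₁ → All (λ e → ¬ e ≺ v) ys₁ →
    All (w ≺_) xs₂ → All (λ e → ¬ e ≺ w) ys₂ →
    length xs₁ ≡ length xs₂
  split-index-unique {[]} {xs₂ = []} _ _ _ _ _ = refl
  split-index-unique {[]} {xs₂ = _ ∷ xs₂} refl _ v≤ (w≺v ∷ _) _ =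
    contradiction w≺v (All.head (++⁻ʳ xs₂ v≤))
  split-index-unique {_ ∷ xs₁} {xs₂ = []} refl (v≺w ∷ _) _ _ w≤ =
    contradiction v≺w (All.head (++⁻ʳ xs₁ w≤))
  split-index-unique {_ ∷ _} {xs₂ = _ ∷ _} eq (_ ∷ bs>) as≮ (_ ∷ cs>) ds≮ =
    cong suc (split-index-unique (∷-injectiveʳ eq) bs> as≮ cs> ds≮)

  leftmostMin-unique : ∀ {l v w j k} → LeftmostMin l v j → LeftmostMin l w k → j ≡ k
  leftmostMin-unique (leftmostMin _ _ refl refl bs> as≮) (leftmostMin _ _ eq refl cs> ds≮) =
    split-index-unique eq bs> as≮ cs> ds≮

  take-before : ∀ {l v k} (lm : LeftmostMin l v k) → take k l ≡ before lm
  take-before (leftmostMin bs as refl refl _ _) = take-length-++ bs _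

  drop-after : ∀ {l v k} (lm : LeftmostMin l v k) → drop (suc k) l ≡ after lm
  drop-after (leftmostMin bs as refl refl _ _) = drop-suc-length-++-∷ bs _ as

  length-before+after : ∀ {l v k} (lm : LeftmostMin l v k) →
    suc (length (before lm) + length (after lm)) ≡ length l
  length-before+after (leftmostMin bs as refl _ _ _) = sym (trans (length-++-sucʳ bs _ as) (cong suc (length-++ bs)))

  length-before-≤ : ∀ {x xs v k} (lm : LeftmostMin (x ∷ xs) v k) → length (before lm) ≤ length xs
  length-before-≤ lm = ≤-trans (m≤m+n _ _) (≤-reflexive (suc-injective (length-before+after lm)))

  length-after-≤ : ∀ {x xs v k} (lm : LeftmostMin (x ∷ xs) v k) → length (after lm) ≤ length xs
  length-after-≤ lm = ≤-trans (m≤n+m _ _) (≤-reflexive (suc-injective (length-before+after lm)))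

  size-ctFuel : ∀ n l → length l ≤ n → size (ctFuel n l) ≡ length l
  size-ctFuel _ [] _ = refl
  size-ctFuel (suc n) (x ∷ xs) (s≤s |xs|≤n) = begin
      suc (size (ctFuel n (take j (x ∷ xs))) + size (ctFuel n (drop (suc j) (x ∷ xs))))
    ≡⟨ cong₂ (λ L R → suc (size (ctFuel n L) + size (ctFuel n R))) (take-before lm) (drop-after lm) ⟩
      suc (size (ctFuel n (before lm)) + size (ctFuel n (after lm)))
    ≡⟨ cong suc (cong₂ _+_ (size-ctFuel n (before lm) (≤-trans (length-before-≤ lm) |xs|≤n))
                           (size-ctFuel n (after lm) (≤-trans (length-after-≤ lm) |xs|≤n))) ⟩
      suc (length (before lm) + length (after lm))
    ≡⟨ length-before+after lm ⟩
      suc (length xs) ∎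
    where
    j : ℕ
    j = lminIdx x xs
    lm : LeftmostMin (x ∷ xs) (proj₁ (lminIdx-leftmostMin x xs)) j
    lm = proj₂ (lminIdx-leftmostMin x xs)

  leftSize-CT : ∀ {l v k} → LeftmostMin l v k → leftSize (CT l) ≡ k
  leftSize-CT {[]} lm = contradiction (length-before+after lm) λ ()
  leftSize-CT {y ∷ ys} {k = k} lm = begin
      size (ctFuel (length ys) (take (lminIdx y ys) (y ∷ ys)))
    ≡⟨ cong (size ∘ ctFuel (length ys)) (take-before lm′) ⟩
      size (ctFuel (length ys) (before lm′))
    ≡⟨ size-ctFuel (length ys) (before lm′) (length-before-≤ lm′) ⟩
      length (before lm′)
    ≡⟨ index lm′ ⟩
      lminIdx y ys
    ≡⟨ leftmostMin-unique lm′ lm ⟩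
      k ∎
    where
    lm′ : LeftmostMin (y ∷ ys) (proj₁ (lminIdx-leftmostMin y ys)) (lminIdx y ys)
    lm′ = proj₂ (lminIdx-leftmostMin y ys)

  ≈CT-leftmostMin-index : ∀ {X Y v w j k} → X ≈CT Y →
    LeftmostMin X v j → LeftmostMin Y w k → j ≡ k
  ≈CT-leftmostMin-index {X} {Y} {j = j} {k} X≈Y lmX lmY = begin
    j                ≡⟨ sym (leftSize-CT lmX) ⟩
    leftSize (CT X)  ≡⟨ cong leftSize X≈Y ⟩
    leftSize (CT Y)  ≡⟨ leftSize-CT lmY ⟩
    k                ∎

  leftmostMin-take : ∀ {l v k n} → LeftmostMin l v k → k < n → LeftmostMin (take n l) v k
  leftmostMin-take {n = n} (leftmostMin bs as refl refl bs> as≮) k<n =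
    leftmostMin bs (take (n ∸ suc (length bs)) as) (take-++-∷ n bs k<n) refl bs> (take⁺ _ as≮)

  leftmostMin-drop : ∀ {l v k n} → LeftmostMin l v k → n ≤ k → LeftmostMin (drop n l) v (k ∸ n)
  leftmostMin-drop {n = n} (leftmostMin bs as refl refl bs> as≮) n≤k =
    leftmostMin (drop n bs) as (drop-++ n bs n≤k) (length-drop n bs) (drop⁺ n bs>) as≮

lemma11 : {c ℓ₁ ℓ₂ : Level} (O : StrictTotalOrder c ℓ₁ ℓ₂) →
    let open StrictTotalOrder O using () renaming (Carrier to A) in
    let open CartesianTree O in
    (x : A) (xs : List A) (p : ℕ) →
    let P = x ∷ xs in
    let m = length P in
    1 ≤ p → p ≤ m / 2 → HasCTBorderPeriod P p →
    ¬ ((suc p ≤ leftmostMinPos x xs) × (leftmostMinPos x xs ≤ m ∸ p))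
lemma11 O x xs p 0<p _ border (s≤s p≤j , j<m∸p) =
  <-irrefl (sym j≡j∸p) (∸-monoʳ-< 0<p p≤j)
  where
  open CartesianTree O using (lminIdx)
  open LeftmostMinimum O
  j≡j∸p : lminIdx x xs ≡ lminIdx x xs ∸ p
  j≡j∸p with lminIdx-leftmostMin x xs
  ... | _ , lm = ≈CT-leftmostMin-index border (leftmostMin-take lm j<m∸p) (leftmostMin-drop lm p≤j)
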